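{- If $T$ is a tree with at least two vertices, then $\mathrm{def}_c(\widetilde{T})\ge |F(T)|-M(T)-2$.
   Context: All graphs are finite, simple and undirected. Let $T$ be a tree with $V(T)=\{v_1,\dots,v_n\}$, $n\ge2$, and let $F(T)$ be the set of vertices of degree $1$ in $T$. For $i\ne j$, let $P(v_i,v_j)$ be the unique path in $T$ between $v_i$ and $v_j$, with vertex set $VP(v_i,v_j)$ and edge set $EP(v_i,v_j)$, and set $LP(v_i,v_j)=|EP(v_i,v_j)|+|\{vw\in E(T): v\in VP(v_i,v_j),\ w\notin VP(v_i,v_j)\}|$ and $M(T)=\max_{1\le i<j\le n}LP(v_i,v_j)$. The graph $\widetilde{T}$ is obtained from $T$ by adding a new vertex $u$ and joining $u$ to every vertex of $F(T)$. A set $A\subseteq\{1,\dots,t\}$ is a cyclic interval modulo $t$ if $A$ or $\{1,\dots,t\}\setminus A$ is an interval of integers; a cyclic interval $t$-coloring is a proper edge coloring with colors $1,\dots,t$ in which the set of colors at every vertex is a cyclic interval modulo $t$. The cyclic deficiency $\mathrm{def}_c(H)$ of a graph $H$ is the minimum number of pendant edges whose attachment to $H$ yields a graph admitting a cyclic interval coloring. -}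

module Defs where

open import Data.Nat using (ℕ; zero; suc; _+_; _∸_; _≤_; _≡ᵇ_)
open import Data.Bool using (Bool; true; false; if_then_else_; not)
open import Data.Fin using (Fin; zero; suc; splitAt)
import Data.Fin as Fin
open import Data.Sum using (_⊎_; inj₁; inj₂)
open import Data.Product using (Σ; ∃; _×_; _,_)
open import Data.List using (List; []; _∷_; length; map; allFin; head; last)
open import Data.Nat.ListAction using (sum)
open import Data.Bool.ListAction using (any)
open import Data.List.Relation.Unary.Unique.Propositional using (Unique)
open import Data.Maybe using (just)
open import Data.Unit using (⊤)
open import Data.Empty using (⊥)
open import Relation.Nullary using (¬_)
open import Relation.Nullary.Decidable using (⌊_⌋)
open import Relation.Binary.PropositionalEquality using (_≡_; _≢_; refl; sym)

record Graph (n : ℕ) : Set where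
  field
    adj     : Fin n → Fin n → Bool
    adj-sym : ∀ i j → adj i j ≡ adj j i
    irrefl  : ∀ i → adj i i ≡ false
open Graph public

𝟙 : Bool → ℕ
𝟙 b = if b then 1 else 0

deg : ∀ {n} → Graph n → Fin n → ℕ
deg {n} G v = sum (map (λ w → 𝟙 (adj G v w)) (allFin n))

isLeaf : ∀ {n} → Graph n → Fin n → Bool
isLeaf G v = deg G v ≡ᵇ 1

numLeaves : ∀ {n} → Graph n → ℕ
numLeaves {n} G = sum (map (λ v → 𝟙 (isLeaf G v)) (allFin n))

Chain : ∀ {n} → Graph n → List (Fin n) → Set
Chain G []           = ⊤
Chain G (x ∷ [])     = ⊤
Chain G (x ∷ y ∷ r)  = adj G x y ≡ true × Chain G (y ∷ r)

IsPath : ∀ {n} → Graph n → Fin n → Fin n → List (Fin n) → Set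
IsPath G a b p = Unique p × Chain G p × head p ≡ just a × last p ≡ just b

IsCycle : ∀ {n} → Graph n → List (Fin n) → Set
IsCycle G p = Unique p × Chain G p × 3 ≤ length p ×
  Σ _ λ a → Σ _ λ b → head p ≡ just a × last p ≡ just b × adj G b a ≡ true

Connected : ∀ {n} → Graph n → Set
Connected G = ∀ a b → ∃ λ p → IsPath G a b p

IsTree : ∀ {n} → Graph n → Set
IsTree G = Connected G × (∀ p → ¬ IsCycle G p)

_∈ᵇ_ : ∀ {n} → Fin n → List (Fin n) → Bool
w ∈ᵇ p = any (λ v → ⌊ w Fin.≟ v ⌋) p

boundary : ∀ {n} → Graph n → List (Fin n) → ℕ
boundary {n} G p =
  sum (map (λ v → sum (map (λ w → 𝟙 (adj G v w Data.Bool.∧ not (w ∈ᵇ p))) (allFin n))) p)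

-- LP of the path with vertex list p: |EP| + number of edges leaving VP
LP : ∀ {n} → Graph n → List (Fin n) → ℕ
LP G p = (length p ∸ 1) + boundary G p

IsM : ∀ {n} → Graph n → ℕ → Set
IsM G m =
  (Σ _ λ i → Σ _ λ j → Σ _ λ p → i ≢ j × IsPath G i j p × LP G p ≡ m) ×
  (∀ i j p → i ≢ j → IsPath G i j p → LP G p ≤ m)

apexAdj : ∀ {n} → Graph n → (Fin n → Bool) → Fin (suc n) → Fin (suc n) → Bool
apexAdj G S zero    zero    = false
apexAdj G S zero    (suc j) = S j
apexAdj G S (suc i) zero    = S i
apexAdj G S (suc i) (suc j) = adj G i j

apexSym : ∀ {n} (G : Graph n) S i j → apexAdj G S i j ≡ apexAdj G S j i
apexSym G S zero    zero    = refl
apexSym G S zero    (suc j) = refl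
apexSym G S (suc i) zero    = refl
apexSym G S (suc i) (suc j) = adj-sym G i j

apexIrr : ∀ {n} (G : Graph n) S i → apexAdj G S i i ≡ false
apexIrr G S zero    = refl
apexIrr G S (suc i) = irrefl G i

addApex : ∀ {n} → Graph n → (Fin n → Bool) → Graph (suc n)
addApex G S = record { adj = apexAdj G S ; adj-sym = apexSym G S ; irrefl = apexIrr G S }

tilde : ∀ {n} → Graph n → Graph (suc n)
tilde G = addApex G (isLeaf G)

-- attach d pendant edges: new vertex k (of d new vertices) is joined to att k only
pendAdj : ∀ {N d} → Graph N → (Fin d → Fin N) → Fin N ⊎ Fin d → Fin N ⊎ Fin d → Bool
pendAdj G att (inj₁ a) (inj₁ b) = adj G a b
pendAdj G att (inj₁ a) (inj₂ k) = ⌊ att k Fin.≟ a ⌋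
pendAdj G att (inj₂ k) (inj₁ a) = ⌊ att k Fin.≟ a ⌋
pendAdj G att (inj₂ k) (inj₂ l) = false

pendSym : ∀ {N d} (G : Graph N) att x y → pendAdj {N} {d} G att x y ≡ pendAdj G att y x
pendSym G att (inj₁ a) (inj₁ b) = adj-sym G a b
pendSym G att (inj₁ a) (inj₂ k) = refl
pendSym G att (inj₂ k) (inj₁ a) = refl
pendSym G att (inj₂ k) (inj₂ l) = refl

pendIrr : ∀ {N d} (G : Graph N) att x → pendAdj {N} {d} G att x x ≡ false
pendIrr G att (inj₁ a) = irrefl G a
pendIrr G att (inj₂ k) = refl

attachPendants : ∀ {N d} → Graph N → (Fin d → Fin N) → Graph (N + d)
attachPendants {N} G att = record
  { adj     = λ x y → pendAdj G att (splitAt N x) (splitAt N y)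
  ; adj-sym = λ x y → pendSym G att (splitAt N x) (splitAt N y)
  ; irrefl  = λ x → pendIrr G att (splitAt N x) }

IsInterval : (ℕ → Set) → Set
IsInterval P = Σ ℕ λ a → Σ ℕ λ b → ∀ k → (P k → a ≤ k × k ≤ b) × (a ≤ k × k ≤ b → P k)

-- A ⊆ {1..t} is a cyclic interval mod t: A or {1..t} \ A is an interval
IsCyclicInterval : ℕ → (ℕ → Set) → Set
IsCyclicInterval t A = IsInterval A ⊎ IsInterval (λ k → (1 ≤ k × k ≤ t) × ¬ A k)

ColorsAt : ∀ {n} → Graph n → (Fin n → Fin n → ℕ) → Fin n → ℕ → Set
ColorsAt G c v k = Σ _ λ w → adj G v w ≡ true × c v w ≡ k

-- c is a cyclic interval t-coloring of G (c v w is the color of edge vw)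
IsCyclicIntervalColoring : ∀ {n} → Graph n → ℕ → (Fin n → Fin n → ℕ) → Set
IsCyclicIntervalColoring G t c =
  (∀ v w → adj G v w ≡ true → c v w ≡ c w v) ×
  (∀ v w → adj G v w ≡ true → 1 ≤ c v w × c v w ≤ t) ×
  (∀ v w w' → adj G v w ≡ true → adj G v w' ≡ true → w ≢ w' → c v w ≢ c v w') ×
  (∀ v → IsCyclicInterval t (ColorsAt G c v))

HasCyclicIntervalColoring : ∀ {n} → Graph n → Set
HasCyclicIntervalColoring G = Σ ℕ λ t → Σ _ λ c → IsCyclicIntervalColoring G t c

-- def_c(H) ≥ k : every attachment of d pendant edges to H yielding a graph
-- with a cyclic interval coloring has d ≥ k
DefcAtLeast : ∀ {N} → Graph N → ℕ → Set
DefcAtLeast {N} H k = ∀ d (att : Fin d → Fin N) →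
  HasCyclicIntervalColoring (attachPendants H att) → k ≤ d

-- Let c be a cyclic interval t-colouring of T̃ with d pendant edges attached, u the
-- apex of T̃. At every vertex, adding t to the colours below the gap of its cyclic
-- interval makes its colours consecutive integers, so any two of them differ by at
-- most deg − 1. Across an edge of T the two unwrapped colours differ by a multiple
-- of t, and since T is a tree these multiples are absorbed by a potential k: the
-- integer Λ v x = t·k v + (unwrapped colour of vx at v) is the same at both ends of
-- each tree edge. Walking along the path between leaves y and z of T therefore moves
-- Λ z u away from Λ y u by at most the sum of deg − 1 over the path; as a path has no
-- chords, that sum is at most |VP| + (edges leaving VP) + d ≤ M(T) + 1 + d. The
-- values Λ z u for the leaves z are distinct, being congruent mod t to the distinct
-- colours at u, so they lie in a window of M(T) + d + 2 integers and
-- |F(T)| ≤ M(T) + d + 2.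

module Submission where

open import Defs
open import Data.Nat using (ℕ; _≤_; _∸_)
open import Data.Bool as Bool using (Bool; true; false; _∧_; not; if_then_else_)
open import Data.Nat as ℕ using (zero; suc; _+_; _*_; _<_; z≤n; s≤s; _<?_)
import Data.Nat.Properties as ℕP
open import Data.Integer as ℤ using (ℤ; +_; -_; ∣_∣)
import Data.Integer.Properties as ℤP
open import Data.Integer.Tactic.RingSolver using (solve-∀)
open import Data.Fin as Fin using (Fin; zero; suc; toℕ; _↑ˡ_; _↑ʳ_)
import Data.Fin.Properties as FinP
open import Data.List using (List; []; _∷_; _++_; [_]; length; map; filter; allFin; tabulate; upTo; head; last; fromMaybe)
import Data.List.Properties as ListP
open import Data.Nat.ListAction using (sum)
open import Algebra.Properties.CommutativeSemigroup ℕP.+-commutativeSemigroup using (interchange)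
open import Data.List.Relation.Unary.All as All using (All; []; _∷_)
import Data.List.Relation.Unary.All.Properties as AllP
open import Data.List.Relation.Unary.AllPairs using ([]; _∷_)
open import Data.List.Relation.Unary.Any using (here; there)
open import Data.List.Relation.Unary.Unique.Propositional using (Unique)
import Data.List.Relation.Unary.Unique.Propositional.Properties as UniqueP
open import Data.List.Membership.Propositional using (_∈_; _∉_)
open import Data.List.Membership.Propositional.Properties
  using (∈-∃++; ∈-++⁻; ∈-++⁺ˡ; ∈-++⁺ʳ; ∈-filter⁺; ∈-filter⁻; ∈-allFin; ∈-map⁺; ∈-map⁻; ∈-upTo⁺)
open import Data.List.Relation.Binary.Subset.Propositional using (_⊆_)
open import Data.List.Extrema ℤP.≤-totalOrder using (min; min≤⊤; min≤xs; argmin-sel)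
open import Data.Maybe using (Maybe; just; nothing)
open import Data.Maybe.Properties using (just-injective)
open import Data.Product using (Σ; ∃; _×_; _,_; proj₁; proj₂)
open import Data.Sum using (_⊎_; inj₁; inj₂)
open import Data.Empty using (⊥; ⊥-elim)
open import Data.Unit using (tt)
open import Function using (_∘_; id)
open import Relation.Nullary using (¬_; yes; no; does)
open import Relation.Nullary.Decidable using (⌊_⌋; dec-true; dec-false; _×-dec_)
open import Relation.Unary using (Decidable)
open import Relation.Binary.PropositionalEquality
  using (_≡_; _≢_; refl; sym; trans; cong; cong₂; subst; subst₂; module ≡-Reasoning)

module _ {A : Set} where

  select : (A → Bool) → List A → List A
  select f = filter (λ x → f x Bool.≟ true)

  sum-𝟙≡length-select : ∀ f xs → sum (map (λ x → 𝟙 (f x)) xs) ≡ length (select f xs)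
  sum-𝟙≡length-select f []       = refl
  sum-𝟙≡length-select f (x ∷ xs) with f x
  ... | true  = cong suc (sum-𝟙≡length-select f xs)
  ... | false = sum-𝟙≡length-select f xs

  Unique⇒⊆⇒length≤ : ∀ {xs ys : List A} → Unique xs → xs ⊆ ys → length xs ≤ length ys
  Unique⇒⊆⇒length≤ {[]}     _            _   = z≤n
  Unique⇒⊆⇒length≤ {x ∷ xs} (x∉xs ∷ uniq) sub with ys₁ , ys₂ , refl ← ∈-∃++ (sub (here refl)) =
    subst (suc (length xs) ≤_) (sym (length-∷-middle ys₁))
      (s≤s (Unique⇒⊆⇒length≤ uniq λ y∈xs →
        ∈-delete ys₁ (sub (there y∈xs)) λ { refl → All.lookup x∉xs y∈xs refl }))
    where
    length-∷-middle : ∀ ys₁ {ys₂} → length (ys₁ ++ x ∷ ys₂) ≡ suc (length (ys₁ ++ ys₂))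
    length-∷-middle []        = refl
    length-∷-middle (_ ∷ ys₁) = cong suc (length-∷-middle ys₁)
    ∈-delete : ∀ ys₁ {ys₂ y} → y ∈ ys₁ ++ x ∷ ys₂ → y ≢ x → y ∈ ys₁ ++ ys₂
    ∈-delete []        (here refl) y≢x = ⊥-elim (y≢x refl)
    ∈-delete []        (there y∈)  _   = y∈
    ∈-delete (_ ∷ ys₁) (here refl) _   = here refl
    ∈-delete (_ ∷ ys₁) (there y∈)  y≢x = there (∈-delete ys₁ y∈ y≢x)

  unique-map⁺ : ∀ {B : Set} (f : A → B) {xs} → (∀ {x y} → x ∈ xs → y ∈ xs → f x ≡ f y → x ≡ y) →
    Unique xs → Unique (map f xs)
  unique-map⁺ f {[]}     _   _            = []
  unique-map⁺ f {x ∷ xs} inj (x∉xs ∷ uniq) =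
    AllP.map⁺ (All.tabulate λ y∈ fx≡fy → All.lookup x∉xs y∈ (inj (here refl) (there y∈) fx≡fy))
      ∷ unique-map⁺ f (λ x∈ y∈ → inj (there x∈) (there y∈)) uniq

count : ∀ {N} → (Fin N → Bool) → ℕ
count {N} f = sum (map (λ x → 𝟙 (f x)) (allFin N))

count≡length-select : ∀ {N} (f : Fin N → Bool) → count f ≡ length (select f (allFin N))
count≡length-select {N} f = sum-𝟙≡length-select f (allFin N)

length≤count : ∀ {N} (f : Fin N → Bool) {ws} → Unique ws → All (λ w → f w ≡ true) ws → length ws ≤ count f
length≤count {N} f uniq fws = subst (_ ≤_) (sym (count≡length-select f))
  (Unique⇒⊆⇒length≤ uniq λ {w} w∈ → ∈-filter⁺ _ (∈-allFin w) (All.lookup fws w∈))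

count≤length : ∀ {N} (f : Fin N → Bool) {L} → (∀ w → f w ≡ true → w ∈ L) → count f ≤ length L
count≤length {N} f f⊆L = subst (_≤ _) (sym (count≡length-select f))
  (Unique⇒⊆⇒length≤ (UniqueP.filter⁺ _ (UniqueP.allFin⁺ N))
    λ w∈ → f⊆L _ (proj₂ (∈-filter⁻ (λ w → f w Bool.≟ true) {xs = allFin N} w∈)))

hits≤count : ∀ {N} (f : Fin N → Bool) (g : Fin N → ℕ) p len →
  (∀ i → i < len → ∃ λ w → f w ≡ true × g w ≡ p + i) → len ≤ count f
hits≤count {N} f g p len hit = subst (_≤ count f) (ListP.length-tabulate choose)
  (length≤count f (UniqueP.tabulate⁺ choose-injective) (AllP.tabulate⁺ (proj₁ ∘ proj₂ ∘ witness)))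
  where
  witness : (i : Fin len) → ∃ λ w → f w ≡ true × g w ≡ p + toℕ i
  witness i = hit (toℕ i) (FinP.toℕ<n i)
  choose : Fin len → Fin N
  choose = proj₁ ∘ witness
  choose-injective : ∀ {i j} → choose i ≡ choose j → i ≡ j
  choose-injective {i} {j} eq = FinP.toℕ-injective (ℕP.+-cancelˡ-≡ p _ _
    (trans (sym (proj₂ (proj₂ (witness i)))) (trans (cong g eq) (proj₂ (proj₂ (witness j))))))

pigeonhole-window : ∀ K (zs : List ℤ) → Unique zs →
  (∀ {y z} → y ∈ zs → z ∈ zs → z ℤ.≤ y ℤ.+ + K) → length zs ≤ suc K
pigeonhole-window K []         _    _      = z≤n
pigeonhole-window K zs@(z ∷ zs′) uniq spread = begin
  length zs     ≤⟨ Unique⇒⊆⇒length≤ uniq zs⊆window ⟩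
  length window ≡⟨ ListP.length-map _ (upTo (suc K)) ⟩
  length (upTo (suc K)) ≡⟨ ListP.length-upTo (suc K) ⟩
  suc K         ∎
  where
  open ℕP.≤-Reasoning
  μ : ℤ
  μ = min z zs′
  μ∈zs : μ ∈ zs
  μ∈zs with argmin-sel id z zs′
  ... | inj₁ μ≡z   = here μ≡z
  ... | inj₂ μ∈zs′ = there μ∈zs′
  μ≤ : ∀ {x} → x ∈ zs → μ ℤ.≤ x
  μ≤ (here refl)  = min≤⊤ z zs′
  μ≤ (there x∈)  = All.lookup (min≤xs z zs′) x∈
  window : List ℤ
  window = map (λ i → μ ℤ.+ + i) (upTo (suc K))
  zs⊆window : zs ⊆ window
  zs⊆window {x} x∈ = subst (_∈ window) x≡ (∈-map⁺ _ (∈-upTo⁺ (s≤s (ℤP.drop‿+≤+ offset≤K))))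
    where
    +offset : + ∣ x ℤ.- μ ∣ ≡ x ℤ.- μ
    +offset = ℤP.0≤i⇒+∣i∣≡i (ℤP.i≤j⇒0≤j-i (μ≤ x∈))
    offset≤K : + ∣ x ℤ.- μ ∣ ℤ.≤ + K
    offset≤K = subst₂ ℤ._≤_ (sym +offset) (shift-back μ (+ K))
      (ℤP.+-monoˡ-≤ (- μ) (spread μ∈zs x∈))
      where
      shift-back : ∀ a b → a ℤ.+ b ℤ.- a ≡ b
      shift-back = solve-∀
    x≡ : μ ℤ.+ + ∣ x ℤ.- μ ∣ ≡ x
    x≡ = trans (cong (λ i → μ ℤ.+ i) +offset) (add-back μ x)
      where
      add-back : ∀ a b → a ℤ.+ (b ℤ.- a) ≡ b
      add-back = solve-∀

-- Unwrapping a cyclic interval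

-- When the complement of A in {1,…,t} is the interval [a, b], the elements of A
-- below a are moved up by t; A then becomes an interval of consecutive integers.
shift : ∀ {t A} → IsCyclicInterval t A → ℕ → ℕ
shift (inj₁ _)           k = 0
shift (inj₂ (a , _ , _)) k = if does (k <? a) then 1 else 0

unwrap : ∀ {t A} → IsCyclicInterval t A → ℕ → ℕ
unwrap {t} ci k = shift ci k * t + k

module Gap {t : ℕ} {A : ℕ → Set} (gap : IsInterval (λ k → (1 ≤ k × k ≤ t) × ¬ A k)) where

  a b : ℕ
  a = proj₁ gap
  b = proj₁ (proj₂ gap)

  unwrap-below : ∀ {k} → k < a → unwrap (inj₂ {A = IsInterval A} gap) k ≡ t + k
  unwrap-below {k} k<a rewrite dec-true (k <? a) k<a = cong (_+ k) (ℕP.+-identityʳ t)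

  unwrap-above : ∀ {k} → ¬ k < a → unwrap (inj₂ {A = IsInterval A} gap) k ≡ k
  unwrap-above {k} k≮a rewrite dec-false (k <? a) k≮a = refl

  gap⇒¬A : ∀ {k} → a ≤ k → k ≤ b → ¬ A k
  gap⇒¬A a≤k k≤b = proj₂ (proj₂ (proj₂ (proj₂ gap) _) (a≤k , k≤b))

  ¬A⇒gap : ∀ {k} → 1 ≤ k → k ≤ t → ¬ A k → a ≤ k × k ≤ b
  ¬A⇒gap 1≤k k≤t ¬Ak = proj₁ (proj₂ (proj₂ gap) _) ((1≤k , k≤t) , ¬Ak)

module _ {t : ℕ} {A : ℕ → Set} (A? : Decidable A) (bounded : ∀ {k} → A k → 1 ≤ k × k ≤ t) where

  unwrap-fills : ∀ (ci : IsCyclicInterval t A) {k₁ k₂ j} → A k₁ → A k₂ →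
    unwrap ci k₁ ≤ j → j ≤ unwrap ci k₂ → ∃ λ k → A k × unwrap ci k ≡ j
  unwrap-fills (inj₁ (a , b , A⇔)) {k₁} {k₂} {j} Ak₁ Ak₂ k₁≤j j≤k₂ =
    j , proj₂ (A⇔ j) (ℕP.≤-trans (proj₁ (proj₁ (A⇔ k₁) Ak₁)) k₁≤j ,
                      ℕP.≤-trans j≤k₂ (proj₂ (proj₁ (A⇔ k₂) Ak₂))) , refl
  unwrap-fills (inj₂ gap) {k₁} {k₂} {j} Ak₁ Ak₂ k₁≤j j≤k₂ with j ℕ.≤? t
  ... | yes j≤t = fill-low
    where
    open Gap gap
    k₁≮a : ¬ k₁ < a
    k₁≮a k₁<a = ℕP.<⇒≱ (ℕP.m<m+n t (proj₁ (bounded Ak₁)))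
                  (ℕP.≤-trans (subst (_≤ j) (unwrap-below k₁<a) k₁≤j) j≤t)
    k₁≤j′ : k₁ ≤ j
    k₁≤j′ = subst (_≤ j) (unwrap-above k₁≮a) k₁≤j
    fill-low : ∃ λ k → A k × unwrap (inj₂ {A = IsInterval A} gap) k ≡ j
    fill-low with A? j
    ... | yes Aj  = j , Aj , unwrap-above (λ j<a → k₁≮a (ℕP.≤-<-trans k₁≤j′ j<a))
    ... | no  ¬Aj = ⊥-elim (gap⇒¬A (ℕP.≮⇒≥ k₁≮a)
          (ℕP.≤-trans k₁≤j′ (proj₂ (¬A⇒gap 1≤j j≤t ¬Aj))) Ak₁)
      where 1≤j = ℕP.≤-trans (proj₁ (bounded Ak₁)) k₁≤j′
  ... | no j≰t = fill-high
    where
    open Gap gap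
    k₂<a : k₂ < a
    k₂<a with k₂ <? a
    ... | yes k₂<a = k₂<a
    ... | no  k₂≮a =
      ⊥-elim (j≰t (ℕP.≤-trans (subst (j ≤_) (unwrap-above k₂≮a) j≤k₂) (proj₂ (bounded Ak₂))))
    i = j ∸ t
    t+i≡j : t + i ≡ j
    t+i≡j = ℕP.m+[n∸m]≡n (ℕP.<⇒≤ (ℕP.≰⇒> j≰t))
    i≤k₂ : i ≤ k₂
    i≤k₂ = ℕP.+-cancelˡ-≤ t i k₂ (subst₂ _≤_ (sym t+i≡j) (unwrap-below k₂<a) j≤k₂)
    fill-high : ∃ λ k → A k × unwrap (inj₂ {A = IsInterval A} gap) k ≡ j
    fill-high with A? i
    ... | yes Ai  = i , Ai , trans (unwrap-below (ℕP.≤-<-trans i≤k₂ k₂<a)) t+i≡j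
    ... | no  ¬Ai = ⊥-elim (ℕP.<⇒≱ (ℕP.≤-<-trans i≤k₂ k₂<a)
          (proj₁ (¬A⇒gap 1≤i (ℕP.≤-trans i≤k₂ (proj₂ (bounded Ak₂))) ¬Ai)))
      where 1≤i = ℕP.m<n⇒0<n∸m (ℕP.≰⇒> j≰t)

colours-at? : ∀ {N} (H : Graph N) (c : Fin N → Fin N → ℕ) x → Decidable (ColorsAt H c x)
colours-at? H c x k = FinP.any? λ w → (adj H x w Bool.≟ true) ×-dec (c x w ℕ.≟ k)

unwrap-spread : ∀ {N} (H : Graph N) (c : Fin N → Fin N → ℕ) {t} x (ci : IsCyclicInterval t (ColorsAt H c x)) →
  (∀ w → adj H x w ≡ true → 1 ≤ c x w × c x w ≤ t) →
  ∀ {w₁ w₂} → adj H x w₁ ≡ true → adj H x w₂ ≡ true →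
  unwrap ci (c x w₂) ≤ unwrap ci (c x w₁) + (deg H x ∸ 1)
unwrap-spread H c x ci bnd {w₁} {w₂} e₁ e₂ with unwrap ci (c x w₂) ℕ.≤? unwrap ci (c x w₁)
... | yes q≤p = ℕP.≤-trans q≤p (ℕP.m≤m+n _ _)
... | no  q≰p =
  ℕP.≤-trans (ℕP.m≤n+m∸n (U w₂) (U w₁)) (ℕP.+-monoʳ-≤ (U w₁) (ℕP.∸-monoˡ-≤ 1 span≤deg))
  where
  U : Fin _ → ℕ
  U w = unwrap ci (c x w)
  span≤deg : suc (U w₂ ∸ U w₁) ≤ deg H x
  span≤deg = hits≤count (adj H x) U (U w₁) (suc (U w₂ ∸ U w₁)) λ i i≤span →
    let k , (w , e , ck≡k) , Uk≡ = unwrap-fills (colours-at? H c x) (λ { (w , e , refl) → bnd w e }) ci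
          (w₁ , e₁ , refl) (w₂ , e₂ , refl) (ℕP.m≤m+n (U w₁) i)
          (ℕP.≤-trans (ℕP.+-monoʳ-≤ (U w₁) (ℕP.≤-pred i≤span))
                      (ℕP.≤-reflexive (ℕP.m+[n∸m]≡n (ℕP.<⇒≤ (ℕP.≰⇒> q≰p)))))
    in w , e , trans (cong (unwrap ci) ck≡k) Uk≡

-- Paths in acyclic graphs

module _ {A : Set} where

  last-∷ʳ : ∀ (xs : List A) x → last (xs ++ [ x ]) ≡ just x
  last-∷ʳ []           x = refl
  last-∷ʳ (_ ∷ [])     x = refl
  last-∷ʳ (_ ∷ y ∷ xs) x = last-∷ʳ (y ∷ xs) x

  last⇒∷ʳ : ∀ {xs : List A} {x} → last xs ≡ just x → ∃ λ ys → xs ≡ ys ++ [ x ]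
  last⇒∷ʳ {_ ∷ []}     refl = [] , refl
  last⇒∷ʳ {y ∷ z ∷ xs} eq   = let ys , ≡ys = last⇒∷ʳ {z ∷ xs} eq in y ∷ ys , cong (y ∷_) ≡ys

  last⇒∈ : ∀ {xs : List A} {x} → last xs ≡ just x → x ∈ xs
  last⇒∈ {xs} eq with ys , refl ← last⇒∷ʳ {xs} eq = ∈-++⁺ʳ ys (here refl)

  Unique-++⁻ˡ : ∀ (xs : List A) {ys} → Unique (xs ++ ys) → Unique xs
  Unique-++⁻ˡ []       _              = []
  Unique-++⁻ˡ (x ∷ xs) (x∉ ∷ uniq) = AllP.++⁻ˡ xs x∉ ∷ Unique-++⁻ˡ xs uniq

  Unique-++⁻ʳ : ∀ (xs : List A) {ys} → Unique (xs ++ ys) → Unique ys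
  Unique-++⁻ʳ []       uniq          = uniq
  Unique-++⁻ʳ (_ ∷ xs) (_ ∷ uniq) = Unique-++⁻ʳ xs uniq

∈ᵇ⇒∈ : ∀ {n} {w : Fin n} xs → w ∈ᵇ xs ≡ true → w ∈ xs
∈ᵇ⇒∈ {w = w} (x ∷ xs) e with w Fin.≟ x
... | yes refl = here refl
... | no  _    = there (∈ᵇ⇒∈ xs e)

∧≡true⁻ : ∀ {a b} → a ∧ b ≡ true → a ≡ true × b ≡ true
∧≡true⁻ {true} {true} _ = refl , refl

Acyclic : ∀ {n} → Graph n → Set
Acyclic G = ∀ p → ¬ IsCycle G p

module _ {n : ℕ} (G : Graph n) where

  adj⇒≢ : ∀ {u v} → adj G u v ≡ true → u ≢ v
  adj⇒≢ {u} e refl with () ← trans (sym e) (irrefl G u)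

  Chain-++⁻ˡ : ∀ xs {ys} → Chain G (xs ++ ys) → Chain G xs
  Chain-++⁻ˡ []           _         = tt
  Chain-++⁻ˡ (_ ∷ [])     _         = tt
  Chain-++⁻ˡ (_ ∷ y ∷ xs) (e , ch) = e , Chain-++⁻ˡ (y ∷ xs) ch

  Chain-++⁻ʳ : ∀ xs {ys} → Chain G (xs ++ ys) → Chain G ys
  Chain-++⁻ʳ []           ch       = ch
  Chain-++⁻ʳ (_ ∷ []) {[]}    _    = tt
  Chain-++⁻ʳ (_ ∷ []) {_ ∷ _} (_ , ch) = ch
  Chain-++⁻ʳ (_ ∷ y ∷ xs) (_ , ch) = Chain-++⁻ʳ (y ∷ xs) ch

  Chain-∷ʳ⁺ : ∀ xs {v w} → Chain G xs → last xs ≡ just v → adj G v w ≡ true → Chain G (xs ++ [ w ])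
  Chain-∷ʳ⁺ (_ ∷ [])     _        refl e = e , tt
  Chain-∷ʳ⁺ (_ ∷ y ∷ xs) (e′ , ch) eq  e = e′ , Chain-∷ʳ⁺ (y ∷ xs) ch eq e

  IsPath-∷ʳ⁺ : ∀ {a b w p} → IsPath G a b p → w ∉ p → adj G b w ≡ true → IsPath G a w (p ++ [ w ])
  IsPath-∷ʳ⁺ {w = w} {p = x ∷ p} (uniq , chain , refl , lp) w∉p e =
    UniqueP.++⁺ uniq (All.[] ∷ []) (λ { (w∈p , here refl) → w∉p w∈p }) ,
    Chain-∷ʳ⁺ (x ∷ p) chain lp e , refl , last-∷ʳ (x ∷ p) w

  IsPath-prefix : ∀ {a b w} α {β} → IsPath G a b (α ++ β) → last α ≡ just w → IsPath G a w α
  IsPath-prefix (x ∷ α) (uniq , chain , refl , _) lα =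
    Unique-++⁻ˡ (x ∷ α) uniq , Chain-++⁻ˡ (x ∷ α) chain , refl , lα

  module _ (acyclic : Acyclic G) where

    no-chord : ∀ u x ys w → Unique (u ∷ x ∷ ys ++ [ w ]) → Chain G (u ∷ x ∷ ys ++ [ w ]) →
      adj G w u ≡ true → ⊥
    no-chord u x ys w uniq chain e = acyclic _ (uniq , chain , 3≤length , u , w , refl , last-∷ʳ (u ∷ x ∷ ys) w , e)
      where
      3≤length : 3 ≤ length (u ∷ x ∷ ys ++ [ w ])
      3≤length = s≤s (s≤s (subst (1 ≤_) (sym (ListP.length-++ ys)) (ℕP.m≤n+m 1 (length ys))))

    neighbour-after : ∀ {v w} β → Unique (v ∷ β) → Chain G (v ∷ β) → adj G v w ≡ true → w ∈ β →
      head β ≡ just w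
    neighbour-after {v} {w} β uniq chain e w∈β with ∈-∃++ w∈β
    ... | []     , β₂ , refl = refl
    ... | x ∷ β₁ , β₂ , refl = ⊥-elim (no-chord v x β₁ w
          (Unique-++⁻ˡ (v ∷ x ∷ β₁ ++ [ w ]) (subst Unique reassoc uniq))
          (Chain-++⁻ˡ (v ∷ x ∷ β₁ ++ [ w ]) (subst (Chain G) reassoc chain))
          (trans (adj-sym G w v) e))
      where
      reassoc : v ∷ x ∷ β₁ ++ w ∷ β₂ ≡ (v ∷ x ∷ β₁ ++ [ w ]) ++ β₂
      reassoc = cong (λ xs → v ∷ x ∷ xs) (sym (ListP.++-assoc β₁ [ w ] β₂))

    neighbour-before : ∀ {v w} α → Unique (α ++ [ v ]) → Chain G (α ++ [ v ]) → adj G v w ≡ true →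
      w ∈ α → last α ≡ just w
    neighbour-before {v} {w} α uniq chain e w∈α with ∈-∃++ w∈α
    ... | α₁ , []     , refl = last-∷ʳ α₁ w
    ... | α₁ , x ∷ α₂ , refl = ⊥-elim (no-chord w x α₂ v
          (Unique-++⁻ʳ α₁ (subst Unique reassoc uniq))
          (Chain-++⁻ʳ α₁ (subst (Chain G) reassoc chain))
          e)
      where
      reassoc : (α₁ ++ w ∷ x ∷ α₂) ++ [ v ] ≡ α₁ ++ w ∷ x ∷ α₂ ++ [ v ]
      reassoc = ListP.++-assoc α₁ (w ∷ x ∷ α₂) [ v ]

    -- x cannot lie on q: it would be a chord at a.
    detour : ∀ {a b x x′} q → x ≢ x′ → adj G a x ≡ true → IsPath G a b (a ∷ x′ ∷ q) →
      IsPath G x b (x ∷ a ∷ x′ ∷ q)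
    detour {a} {x = x} {x′} q x≢x′ ax (a∉q ∷ uq , (ax′ , cq) , refl , lq) =
      AllP.¬Any⇒All¬ _ x∉q ∷ a∉q ∷ uq , (trans (adj-sym G x a) ax , ax′ , cq) , refl , lq
      where
      x∉q : x ∉ a ∷ x′ ∷ q
      x∉q (here x≡a)  = adj⇒≢ ax (sym x≡a)
      x∉q (there x∈q) = x≢x′ (sym (just-injective
                          (neighbour-after (x′ ∷ q) (a∉q ∷ uq) (ax′ , cq) ax x∈q)))

    -- When the paths leave a along different edges, the detour is a second path
    -- from x; by induction it equals the first, which would then revisit a.
    path-tails-unique : ∀ {a b} xs ys → IsPath G a b (a ∷ xs) → IsPath G a b (a ∷ ys) → xs ≡ ys
    path-tails-unique []      []      _ _ = refl
    path-tails-unique []      (_ ∷ _) (_ , _ , _ , refl) (a∉ ∷ _ , _ , _ , lq) =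
      ⊥-elim (All.lookup a∉ (last⇒∈ lq) refl)
    path-tails-unique (_ ∷ _) []      (a∉ ∷ _ , _ , _ , lp) (_ , _ , _ , refl) =
      ⊥-elim (All.lookup a∉ (last⇒∈ lp) refl)
    path-tails-unique {a} (x ∷ p) (x′ ∷ q) (a∉p ∷ up , (ax , cp) , _ , lp) Q@(_ ∷ uq , (_ , cq) , _ , lq)
      with x Fin.≟ x′
    ... | yes refl = cong (x ∷_) (path-tails-unique p q (up , cp , refl , lp) (uq , cq , refl , lq))
    ... | no  x≢x′ = ⊥-elim (All.lookup a∉p (subst (a ∈_)
      (sym (cong (x ∷_) (path-tails-unique p (a ∷ x′ ∷ q) (up , cp , refl , lp) (detour q x≢x′ ax Q))))
      (there (here refl))) refl)

    path-unique : ∀ {a b} p q → IsPath G a b p → IsPath G a b q → p ≡ q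
    path-unique (a ∷ xs) (_ ∷ ys) P@(_ , _ , refl , _) Q@(_ , _ , refl , _) = cong (a ∷_) (path-tails-unique xs ys P Q)

    path-neighbours≤2 : ∀ α v β → Unique (α ++ v ∷ β) → Chain G (α ++ v ∷ β) →
      count (λ w → adj G v w ∧ (w ∈ᵇ (α ++ v ∷ β))) ≤ 2
    path-neighbours≤2 α v β uniq chain = ℕP.≤-trans (count≤length _ neighbour∈)
      (ℕP.≤-trans (ℕP.≤-reflexive (ListP.length-++ (fromMaybe (last α))))
                  (ℕP.+-mono-≤ (length-fromMaybe (last α)) (length-fromMaybe (head β))))
      where
      split : α ++ v ∷ β ≡ (α ++ [ v ]) ++ β
      split = sym (ListP.++-assoc α [ v ] β)
      length-fromMaybe : (m : Maybe (Fin n)) → length (fromMaybe m) ≤ 1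
      length-fromMaybe nothing  = z≤n
      length-fromMaybe (just _) = s≤s z≤n
      neighbour∈ : ∀ w → adj G v w ∧ (w ∈ᵇ (α ++ v ∷ β)) ≡ true →
        w ∈ fromMaybe (last α) ++ fromMaybe (head β)
      neighbour∈ w e with vw , w∈ᵇ ← ∧≡true⁻ {adj G v w} e
                     with ∈-++⁻ α (∈ᵇ⇒∈ (α ++ v ∷ β) w∈ᵇ)
      ... | inj₁ w∈α = ∈-++⁺ˡ (subst (λ m → w ∈ fromMaybe m)
              (sym (neighbour-before α (Unique-++⁻ˡ (α ++ [ v ]) (subst Unique split uniq))
                    (Chain-++⁻ˡ (α ++ [ v ]) (subst (Chain G) split chain)) vw w∈α)) (here refl))
      ... | inj₂ (here refl)  = ⊥-elim (adj⇒≢ vw refl)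
      ... | inj₂ (there w∈β) = ∈-++⁺ʳ (fromMaybe (last α)) (subst (λ m → w ∈ fromMaybe m)
              (sym (neighbour-after β (Unique-++⁻ʳ α uniq) (Chain-++⁻ʳ α chain) vw w∈β)) (here refl))

-- Potentials on trees

sum-along : ∀ {n} → (Fin n → Fin n → ℤ) → List (Fin n) → ℤ
sum-along h (x ∷ y ∷ xs) = h x y ℤ.+ sum-along h (y ∷ xs)
sum-along h _            = + 0

sum-along-∷ʳ : ∀ {n} (h : Fin n → Fin n → ℤ) xs {v} w → last xs ≡ just v →
  sum-along h (xs ++ [ w ]) ≡ sum-along h xs ℤ.+ h v w
sum-along-∷ʳ h (x ∷ [])     w refl = trans (ℤP.+-identityʳ (h x w)) (sym (ℤP.+-identityˡ (h x w)))
sum-along-∷ʳ h (x ∷ y ∷ xs) w eq   =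
  trans (cong (λ s → h x y ℤ.+ s) (sum-along-∷ʳ h (y ∷ xs) w eq)) (sym (ℤP.+-assoc (h x y) _ _))

module _ {n : ℕ} (G : Graph n) (tree : IsTree G) (root : Fin n) where

  open import Data.List.Membership.DecPropositional (Fin._≟_ {n}) using (_∈?_)

  path-from-root : Fin n → List (Fin n)
  path-from-root v = proj₁ (proj₁ tree root v)

  IsPath-from-root : ∀ v → IsPath G root v (path-from-root v)
  IsPath-from-root v = proj₂ (proj₁ tree root v)

  root-path-extends : ∀ v w → adj G v w ≡ true →
    path-from-root w ≡ path-from-root v ++ [ w ] ⊎ path-from-root v ≡ path-from-root w ++ [ v ]
  root-path-extends v w e with w ∈? path-from-root v
  ... | no  w∉ = inj₁ (path-unique G (proj₂ tree) _ _
    (IsPath-from-root w) (IsPath-∷ʳ⁺ G (IsPath-from-root v) w∉ e))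
  ... | yes w∈ with last⇒∷ʳ {xs = path-from-root v} (proj₂ (proj₂ (proj₂ (IsPath-from-root v))))
  ...   | α , Pv≡ =
    inj₂ (trans Pv≡ (cong (_++ [ v ]) (path-unique G (proj₂ tree) _ _ α-path (IsPath-from-root w))))
    where
    α-path : IsPath G root w α
    α-path with ∈-++⁻ α (subst (w ∈_) Pv≡ w∈)
    ... | inj₂ (here w≡v) = ⊥-elim (adj⇒≢ G e (sym w≡v))
    ... | inj₁ w∈α = IsPath-prefix G α (subst (IsPath G root v) Pv≡ (IsPath-from-root v))
          (neighbour-before G (proj₂ tree) α (subst Unique Pv≡ (proj₁ (IsPath-from-root v)))
            (subst (Chain G) Pv≡ (proj₁ (proj₂ (IsPath-from-root v))))
            e w∈α)

  tree-potential : (h : Fin n → Fin n → ℤ) → (∀ {v w} → adj G v w ≡ true → h w v ≡ ℤ.- h v w) →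
    Σ (Fin n → ℤ) λ k → ∀ {v w} → adj G v w ≡ true → k w ≡ k v ℤ.+ h v w
  tree-potential h antisym = k , k-step
    where
    k : Fin n → ℤ
    k v = sum-along h (path-from-root v)
    k-∷ʳ : ∀ {v w} → path-from-root w ≡ path-from-root v ++ [ w ] → k w ≡ k v ℤ.+ h v w
    k-∷ʳ {v} {w} eq = trans (cong (sum-along h) eq)
      (sum-along-∷ʳ h (path-from-root v) w (proj₂ (proj₂ (proj₂ (IsPath-from-root v)))))
    k-step : ∀ {v w} → adj G v w ≡ true → k w ≡ k v ℤ.+ h v w
    k-step {v} {w} e with root-path-extends v w e
    ... | inj₁ Pw≡ = k-∷ʳ Pw≡
    ... | inj₂ Pv≡ = begin
      k w                             ≡⟨ cancel (k w) (h v w) ⟩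
      k w ℤ.+ ℤ.- h v w ℤ.+ h v w     ≡⟨ cong (λ z → k w ℤ.+ z ℤ.+ h v w) (sym (antisym e)) ⟩
      k w ℤ.+ h w v ℤ.+ h v w         ≡⟨ cong (λ z → z ℤ.+ h v w) (sym (k-∷ʳ Pv≡)) ⟩
      k v ℤ.+ h v w                   ∎
      where
      open ≡-Reasoning
      cancel : ∀ a b → a ≡ a ℤ.+ ℤ.- b ℤ.+ b
      cancel = solve-∀

-- Degrees in T̃ with pendant edges attached

module _ {A : Set} where

  sum-map-+ : ∀ (f g : A → ℕ) xs → sum (map (λ x → f x + g x) xs) ≡ sum (map f xs) + sum (map g xs)
  sum-map-+ f g []       = refl
  sum-map-+ f g (x ∷ xs) = trans (cong (λ s → f x + g x + s) (sum-map-+ f g xs)) (interchange (f x) (g x) _ _)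

  sum-map-mono : ∀ (f g : A → ℕ) xs → (∀ x → x ∈ xs → f x ≤ g x) → sum (map f xs) ≤ sum (map g xs)
  sum-map-mono f g []       _   = z≤n
  sum-map-mono f g (x ∷ xs) f≤g =
    ℕP.+-mono-≤ (f≤g x (here refl)) (sum-map-mono f g xs (λ y y∈ → f≤g y (there y∈)))

  sum-map-const : ∀ k (xs : List A) → sum (map (λ _ → k) xs) ≡ length xs * k
  sum-map-const k []       = refl
  sum-map-const k (x ∷ xs) = cong (λ s → k + s) (sum-map-const k xs)

sum-swap : ∀ {A B : Set} (F : A → B → ℕ) xs ys →
  sum (map (λ x → sum (map (F x) ys)) xs) ≡ sum (map (λ y → sum (map (λ x → F x y) xs)) ys)
sum-swap F []       ys = sym (trans (sum-map-const 0 ys) (ℕP.*-zeroʳ (length ys)))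
sum-swap F (x ∷ xs) ys = trans (cong (λ s → sum (map (F x) ys) + s) (sum-swap F xs ys))
  (sym (sum-map-+ (F x) (λ y → sum (map (λ x′ → F x′ y) xs)) ys))

sum-map-allFin : ∀ {N} (f : Fin N → ℕ) → sum (map f (allFin N)) ≡ sum (tabulate f)
sum-map-allFin f = cong sum (ListP.map-tabulate id f)

sum-tabulate-+ : ∀ m {d} (f : Fin (m + d) → ℕ) →
  sum (tabulate f) ≡ sum (tabulate (f ∘ (_↑ˡ d))) + sum (tabulate (f ∘ (m ↑ʳ_)))
sum-tabulate-+ zero    f = refl
sum-tabulate-+ (suc m) f =
  trans (cong (λ s → f zero + s) (sum-tabulate-+ m (f ∘ suc))) (sym (ℕP.+-assoc (f zero) _ _))

count-split : ∀ {N} (f g : Fin N → Bool) →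
  count f ≡ count (λ w → f w ∧ g w) + count (λ w → f w ∧ not (g w))
count-split {N} f g = trans (cong sum (ListP.map-cong (λ w → 𝟙-split (f w) (g w)) (allFin N)))
  (sum-map-+ (λ w → 𝟙 (f w ∧ g w)) (λ w → 𝟙 (f w ∧ not (g w))) (allFin N))
  where
  𝟙-split : ∀ a b → 𝟙 a ≡ 𝟙 (a ∧ b) + 𝟙 (a ∧ not b)
  𝟙-split false _     = refl
  𝟙-split true  true  = refl
  𝟙-split true  false = refl

module Pendants {n d : ℕ} (T : Graph n) (att : Fin d → Fin (suc n)) where

  G′ : Graph (suc n + d)
  G′ = attachPendants (tilde T) att

  ι : Fin n → Fin (suc n + d)
  ι v = suc v ↑ˡ d

  apex : Fin (suc n + d)
  apex = zero ↑ˡ d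

  pendants : Fin n → ℕ
  pendants v = count (λ k → ⌊ att k Fin.≟ suc v ⌋)

  adj-ι-ι : ∀ v w → adj G′ (ι v) (ι w) ≡ adj T v w
  adj-ι-ι v w rewrite FinP.splitAt-↑ˡ (suc n) (suc v) d | FinP.splitAt-↑ˡ (suc n) (suc w) d = refl

  adj-ι-apex : ∀ v → adj G′ (ι v) apex ≡ isLeaf T v
  adj-ι-apex v rewrite FinP.splitAt-↑ˡ (suc n) (suc v) d | FinP.splitAt-↑ˡ (suc n) zero d = refl

  adj-ι-pendant : ∀ v k → adj G′ (ι v) (suc n ↑ʳ k) ≡ ⌊ att k Fin.≟ suc v ⌋
  adj-ι-pendant v k rewrite FinP.splitAt-↑ˡ (suc n) (suc v) d | FinP.splitAt-↑ʳ (suc n) d k = refl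

  deg-ι : ∀ v → deg G′ (ι v) ≡ 𝟙 (isLeaf T v) + deg T v + pendants v
  deg-ι v = trans (sum-map-allFin (𝟙 ∘ adj G′ (ι v))) (trans (sum-tabulate-+ (suc n) (𝟙 ∘ adj G′ (ι v)))
    (cong₂ _+_ (cong₂ _+_ (cong 𝟙 (adj-ι-apex v)) (retabulate (λ w → cong 𝟙 (adj-ι-ι v w))))
               (retabulate (λ k → cong 𝟙 (adj-ι-pendant v k)))))
    where
    retabulate : ∀ {N} {f g : Fin N → ℕ} → (∀ i → f i ≡ g i) → sum (tabulate f) ≡ sum (map g (allFin N))
    retabulate {g = g} f≗g = trans (cong sum (ListP.tabulate-cong f≗g)) (sym (sum-map-allFin g))

  sum-pendants≤ : ∀ {Q} → Unique Q → sum (map pendants Q) ≤ d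
  sum-pendants≤ {Q} uniq = begin
    sum (map pendants Q)
      ≡⟨ sum-swap _ Q (allFin d) ⟩
    sum (map (λ k → sum (map (λ v → 𝟙 ⌊ att k Fin.≟ suc v ⌋) Q)) (allFin d))
      ≤⟨ sum-map-mono _ _ (allFin d) (λ k _ → hits≤1 (att k) uniq) ⟩
    sum (map (λ _ → 1) (allFin d))
      ≡⟨ sum-map-const 1 (allFin d) ⟩
    length (allFin d) * 1
      ≡⟨ ℕP.*-identityʳ _ ⟩
    length (allFin d)
      ≡⟨ ListP.length-tabulate id ⟩
    d ∎
    where
    open ℕP.≤-Reasoning
    hits≤1 : ∀ (y : Fin (suc n)) {Q} → Unique Q → sum (map (λ v → 𝟙 ⌊ y Fin.≟ suc v ⌋) Q) ≤ 1
    hits≤1 y {[]}    _             = z≤n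
    hits≤1 y {v ∷ Q} (v∉Q ∷ uniq) with y Fin.≟ suc v
    ... | no  _    = hits≤1 y uniq
    ... | yes refl = s≤s (ℕP.≤-reflexive (no-more-hits v∉Q))
      where
      no-more-hits : ∀ {ws} → All (v ≢_) ws → sum (map (λ w → 𝟙 ⌊ suc v Fin.≟ suc w ⌋) ws) ≡ 0
      no-more-hits []                    = refl
      no-more-hits {w ∷ _} (v≢w ∷ v∉ws) with v Fin.≟ w
      ... | yes v≡w = ⊥-elim (v≢w v≡w)
      ... | no  _   = no-more-hits v∉ws

  outside : List (Fin n) → Fin n → ℕ
  outside Q v = count (λ w → adj T v w ∧ not (w ∈ᵇ Q))

  module _ (acyclic : Acyclic T) {Q : List (Fin n)} (uniq : Unique Q) (chain : Chain T Q) where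

    leaf+deg≤2+outside : ∀ {v} → v ∈ Q → 𝟙 (isLeaf T v) + deg T v ≤ 2 + outside Q v
    leaf+deg≤2+outside {v} v∈Q with deg T v ℕ.≡ᵇ 1 in leaf
    ... | true  rewrite ℕP.≡ᵇ⇒≡ (deg T v) 1 (subst Bool.T (sym leaf) tt) = ℕP.m≤m+n 2 _
    ... | false with α , β , refl ← ∈-∃++ v∈Q = begin
      deg T v
        ≡⟨ count-split (adj T v) (_∈ᵇ Q) ⟩
      count (λ w → adj T v w ∧ (w ∈ᵇ Q)) + outside Q v
        ≤⟨ ℕP.+-monoˡ-≤ _ (path-neighbours≤2 T acyclic α v β uniq chain) ⟩
      2 + outside Q v ∎
      where open ℕP.≤-Reasoning

    path-degree-sum : sum (map (λ v → deg G′ (ι v) ∸ 1) Q) ≤ length Q + boundary T Q + d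
    path-degree-sum = begin
      sum (map (λ v → deg G′ (ι v) ∸ 1) Q)
        ≤⟨ sum-map-mono _ _ Q degree-bound ⟩
      sum (map (λ v → 1 + (outside Q v + pendants v)) Q)
        ≡⟨ sum-map-+ _ _ Q ⟩
      sum (map (λ _ → 1) Q) + sum (map (λ v → outside Q v + pendants v) Q)
        ≡⟨ cong₂ _+_ (trans (sum-map-const 1 Q) (ℕP.*-identityʳ (length Q))) (sum-map-+ (outside Q) pendants Q) ⟩
      length Q + (boundary T Q + sum (map pendants Q))
        ≤⟨ ℕP.+-monoʳ-≤ (length Q) (ℕP.+-monoʳ-≤ (boundary T Q) (sum-pendants≤ uniq)) ⟩
      length Q + (boundary T Q + d)
        ≡⟨ sym (ℕP.+-assoc (length Q) _ d) ⟩
      length Q + boundary T Q + d ∎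
      where
      open ℕP.≤-Reasoning
      degree-bound : ∀ v → v ∈ Q → deg G′ (ι v) ∸ 1 ≤ 1 + (outside Q v + pendants v)
      degree-bound v v∈Q rewrite deg-ι v =
        ℕP.∸-monoˡ-≤ 1 (ℕP.+-monoˡ-≤ (pendants v) (leaf+deg≤2+outside v∈Q))

-- Lifting the colouring to the integers

residue-unique : ∀ {t a b} (A B : ℤ) → 1 ≤ a → a ≤ t → 1 ≤ b → b ≤ t →
  + t ℤ.* A ℤ.+ + a ≡ + t ℤ.* B ℤ.+ + b → a ≡ b
residue-unique {t} {a} {b} A B 1≤a a≤t 1≤b b≤t eq = by-offset (B ℤ.- A) (a≡b+tD A B (+ t) (+ a) (+ b) eq)
  where
  a≡b+tD : ∀ A B t a b → t ℤ.* A ℤ.+ a ≡ t ℤ.* B ℤ.+ b → a ≡ b ℤ.+ t ℤ.* (B ℤ.- A)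
  a≡b+tD A B t a b eq = trans (move A t a) (trans (cong (λ z → z ℤ.- t ℤ.* A) eq) (regroup A B t b))
    where
    move : ∀ A t a → a ≡ t ℤ.* A ℤ.+ a ℤ.- t ℤ.* A
    move = solve-∀
    regroup : ∀ A B t b → t ℤ.* B ℤ.+ b ℤ.- t ℤ.* A ≡ b ℤ.+ t ℤ.* (B ℤ.- A)
    regroup = solve-∀
  overflow : ∀ {a b} j → 1 ≤ b → a ≤ t → + a ≡ + b ℤ.+ + t ℤ.* + suc j → ⊥
  overflow {a} {b} j 1≤b a≤t eq =
    ℕP.<⇒≱ (ℕP.+-mono-≤ 1≤b (ℕP.m≤m*n t (suc j))) (ℕP.≤-trans (ℕP.≤-reflexive (sym a≡)) a≤t)
    where
    a≡ : a ≡ b + t * suc j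
    a≡ = ℤP.+-injective (trans eq (cong (λ z → + b ℤ.+ z) (sym (ℤP.pos-* t (suc j)))))
  by-offset : ∀ D → + a ≡ + b ℤ.+ + t ℤ.* D → a ≡ b
  by-offset (+ zero)   eq =
    ℤP.+-injective (trans eq (trans (cong (λ z → + b ℤ.+ z) (ℤP.*-zeroʳ (+ t))) (ℤP.+-identityʳ (+ b))))
  by-offset (+ suc j)  eq = ⊥-elim (overflow j 1≤b a≤t eq)
  by-offset ℤ.-[1+ j ] eq = ⊥-elim (overflow j 1≤a b≤t (flip (+ a) (+ b) (+ t) ℤ.-[1+ j ] eq))
    where
    flip : ∀ a b t D → a ≡ b ℤ.+ t ℤ.* D → b ≡ a ℤ.+ t ℤ.* (ℤ.- D)
    flip _ b t D refl = cancel b t D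
      where
      cancel : ∀ b t D → b ≡ b ℤ.+ t ℤ.* D ℤ.+ t ℤ.* (ℤ.- D)
      cancel = solve-∀

module Lifting {n d : ℕ} (T : Graph n) (tree : IsTree T) (root : Fin n)
  (att : Fin d → Fin (suc n)) {t : ℕ} {c : Fin (suc n + d) → Fin (suc n + d) → ℕ}
  (colouring : IsCyclicIntervalColoring (Pendants.G′ T att) t c) where

  open Pendants T att

  c-sym : ∀ v w → adj G′ v w ≡ true → c v w ≡ c w v
  c-sym = proj₁ colouring

  c-range : ∀ v w → adj G′ v w ≡ true → 1 ≤ c v w × c v w ≤ t
  c-range = proj₁ (proj₂ colouring)

  c-proper : ∀ v w w′ → adj G′ v w ≡ true → adj G′ v w′ ≡ true → w ≢ w′ → c v w ≢ c v w′
  c-proper = proj₁ (proj₂ (proj₂ colouring))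

  c-cyclic : ∀ v → IsCyclicInterval t (ColorsAt G′ c v)
  c-cyclic = proj₂ (proj₂ (proj₂ colouring))

  U s : Fin n → Fin (suc n + d) → ℕ
  U v x = unwrap (c-cyclic (ι v)) (c (ι v) x)
  s v x = shift (c-cyclic (ι v)) (c (ι v) x)

  +U : ∀ v x → + U v x ≡ + s v x ℤ.* + t ℤ.+ + c (ι v) x
  +U v x = trans (ℤP.pos-+ (s v x * t) _) (cong (λ z → z ℤ.+ + c (ι v) x) (ℤP.pos-* (s v x) t))

  D : Fin n → ℕ
  D v = deg G′ (ι v) ∸ 1

  U-spread : ∀ {v x y} → adj G′ (ι v) x ≡ true → adj G′ (ι v) y ≡ true → U v y ≤ U v x + D v
  U-spread {v} = unwrap-spread G′ c (ι v) (c-cyclic (ι v)) (c-range (ι v))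

  h : Fin n → Fin n → ℤ
  h v w = + s v (ι w) ℤ.- + s w (ι v)

  h-antisym : ∀ {v w} → adj T v w ≡ true → h w v ≡ ℤ.- h v w
  h-antisym {v} {w} _ = swap (+ s v (ι w)) (+ s w (ι v))
    where
    swap : ∀ a b → b ℤ.- a ≡ ℤ.- (a ℤ.- b)
    swap = solve-∀

  k : Fin n → ℤ
  k = proj₁ (tree-potential T tree root h h-antisym)

  k-step : ∀ {v w} → adj T v w ≡ true → k w ≡ k v ℤ.+ h v w
  k-step = proj₂ (tree-potential T tree root h h-antisym)

  Λ : Fin n → Fin (suc n + d) → ℤ
  Λ v x = + t ℤ.* k v ℤ.+ + U v x

  Λ-edge : ∀ {v w} → adj T v w ≡ true → Λ v (ι w) ≡ Λ w (ι v)
  Λ-edge {v} {w} e = begin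
    + t ℤ.* k v ℤ.+ + U v (ι w)
      ≡⟨ cong (λ z → + t ℤ.* k v ℤ.+ z) (+U v (ι w)) ⟩
    + t ℤ.* k v ℤ.+ (+ s v (ι w) ℤ.* + t ℤ.+ + c (ι v) (ι w))
      ≡⟨ regroup (+ t) (k v) (+ s v (ι w)) (+ s w (ι v)) _ ⟩
    + t ℤ.* (k v ℤ.+ h v w) ℤ.+ (+ s w (ι v) ℤ.* + t ℤ.+ + c (ι v) (ι w))
      ≡⟨ cong₂ (λ z y → + t ℤ.* z ℤ.+ (+ s w (ι v) ℤ.* + t ℤ.+ + y))
               (sym (k-step e)) (c-sym (ι v) (ι w) (trans (adj-ι-ι v w) e)) ⟩
    + t ℤ.* k w ℤ.+ (+ s w (ι v) ℤ.* + t ℤ.+ + c (ι w) (ι v))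
      ≡⟨ cong (λ z → + t ℤ.* k w ℤ.+ z) (sym (+U w (ι v))) ⟩
    + t ℤ.* k w ℤ.+ + U w (ι v) ∎
    where
    open ≡-Reasoning
    regroup : ∀ t k a b c → t ℤ.* k ℤ.+ (a ℤ.* t ℤ.+ c) ≡ t ℤ.* (k ℤ.+ (a ℤ.- b)) ℤ.+ (b ℤ.* t ℤ.+ c)
    regroup = solve-∀

  Λ-spread : ∀ {v x y} → adj G′ (ι v) x ≡ true → adj G′ (ι v) y ≡ true → Λ v y ℤ.≤ Λ v x ℤ.+ + D v
  Λ-spread {v} {x} {y} ex ey = begin
    + t ℤ.* k v ℤ.+ + U v y              ≤⟨ ℤP.+-monoʳ-≤ (+ t ℤ.* k v) (ℤ.+≤+ (U-spread ex ey)) ⟩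
    + t ℤ.* k v ℤ.+ + (U v x + D v)      ≡⟨ cong (λ z → + t ℤ.* k v ℤ.+ z) (ℤP.pos-+ (U v x) (D v)) ⟩
    + t ℤ.* k v ℤ.+ (+ U v x ℤ.+ + D v)  ≡⟨ sym (ℤP.+-assoc (+ t ℤ.* k v) _ _) ⟩
    Λ v x ℤ.+ + D v                      ∎
    where open ℤP.≤-Reasoning

  Λ-along-path : ∀ q rest {z x} → Chain T (q ∷ rest) → last (q ∷ rest) ≡ just z →
    adj G′ (ι z) apex ≡ true → adj G′ (ι q) x ≡ true →
    Λ z apex ℤ.≤ Λ q x ℤ.+ + sum (map D (q ∷ rest))
  Λ-along-path q [] {x = x} _ refl ez ex =
    subst (λ m → Λ q apex ℤ.≤ Λ q x ℤ.+ + m) (sym (ℕP.+-identityʳ (D q))) (Λ-spread ex ez)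
  Λ-along-path q (q′ ∷ rest) {z} {x} (e , chain) lz ez ex = begin
    Λ z apex
      ≤⟨ Λ-along-path q′ rest chain lz ez (trans (adj-ι-ι q′ q) (trans (adj-sym T q′ q) e)) ⟩
    Λ q′ (ι q) ℤ.+ + Σrest
      ≡⟨ cong (λ y → y ℤ.+ + Σrest) (sym (Λ-edge e)) ⟩
    Λ q (ι q′) ℤ.+ + Σrest
      ≤⟨ ℤP.+-monoˡ-≤ (+ Σrest) (Λ-spread ex (trans (adj-ι-ι q q′) e)) ⟩
    Λ q x ℤ.+ + D q ℤ.+ + Σrest
      ≡⟨ ℤP.+-assoc (Λ q x) (+ D q) (+ Σrest) ⟩
    Λ q x ℤ.+ (+ D q ℤ.+ + Σrest)
      ≡⟨ cong (λ y → Λ q x ℤ.+ y) (sym (ℤP.pos-+ (D q) Σrest)) ⟩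
    Λ q x ℤ.+ + sum (map D (q ∷ q′ ∷ rest)) ∎
    where
    open ℤP.≤-Reasoning
    Σrest = sum (map D (q′ ∷ rest))

  φ : Fin n → ℤ
  φ v = Λ v apex

  φ-injective : ∀ {x y} → isLeaf T x ≡ true → isLeaf T y ≡ true → φ x ≡ φ y → x ≡ y
  φ-injective {x} {y} lx ly φx≡φy with ι x Fin.≟ ι y
  ... | yes ιx≡ιy = FinP.suc-injective (FinP.↑ˡ-injective d (suc x) (suc y) ιx≡ιy)
  ... | no  ιx≢ιy = ⊥-elim (c-proper apex (ι x) (ι y)
      (trans (adj-sym G′ apex (ι x)) ex) (trans (adj-sym G′ apex (ι y)) ey) ιx≢ιy
      (trans (sym (c-sym (ι x) apex ex)) (trans same-colour (c-sym (ι y) apex ey))))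
    where
    ex = trans (adj-ι-apex x) lx
    ey = trans (adj-ι-apex y) ly
    φ≡ : ∀ v → φ v ≡ + t ℤ.* (k v ℤ.+ + s v apex) ℤ.+ + c (ι v) apex
    φ≡ v = trans (cong (λ z → + t ℤ.* k v ℤ.+ z) (+U v apex)) (regroup (+ t) (k v) (+ s v apex) _)
      where
      regroup : ∀ t k a c → t ℤ.* k ℤ.+ (a ℤ.* t ℤ.+ c) ≡ t ℤ.* (k ℤ.+ a) ℤ.+ c
      regroup = solve-∀
    same-colour : c (ι x) apex ≡ c (ι y) apex
    same-colour = residue-unique _ _ (proj₁ (c-range _ _ ex)) (proj₂ (c-range _ _ ex))
      (proj₁ (c-range _ _ ey)) (proj₂ (c-range _ _ ey)) (trans (sym (φ≡ x)) (trans φx≡φy (φ≡ y)))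

  module _ {m : ℕ} (LP≤m : ∀ i j p → i ≢ j → IsPath T i j p → LP T p ≤ m) where

    leaves-window : ∀ {y z} → isLeaf T y ≡ true → isLeaf T z ≡ true → φ z ℤ.≤ φ y ℤ.+ + (suc m + d)
    leaves-window {y} {z} ly lz with y Fin.≟ z | proj₁ tree y z
    ... | yes refl | _ = ℤP.i≤i+j (φ y) (+ (suc m + d))
    ... | no  y≢z  | [] , (_ , _ , () , _)
    ... | no  y≢z  | p@(_ ∷ rest) , path@(uniq , chain , refl , lp) = begin
      φ z
        ≤⟨ Λ-along-path y rest chain lp (trans (adj-ι-apex z) lz) (trans (adj-ι-apex y) ly) ⟩
      φ y ℤ.+ + sum (map D p)
        ≤⟨ ℤP.+-monoʳ-≤ (φ y) (ℤ.+≤+ path-bound) ⟩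
      φ y ℤ.+ + (suc m + d) ∎
      where
      open ℤP.≤-Reasoning
      path-bound : sum (map D p) ≤ suc m + d
      path-bound = ℕP.≤-trans (path-degree-sum (proj₂ tree) uniq chain)
                              (ℕP.+-monoˡ-≤ d (s≤s (LP≤m y z p y≢z path)))

    numLeaves≤ : numLeaves T ≤ suc (suc m + d)
    numLeaves≤ = begin
      numLeaves T             ≡⟨ count≡length-select (isLeaf T) ⟩
      length leaves           ≡⟨ sym (ListP.length-map φ leaves) ⟩
      length (map φ leaves)   ≤⟨ pigeonhole-window (suc m + d) (map φ leaves) φ-leaves-unique window ⟩
      suc (suc m + d)         ∎
      where
      open ℕP.≤-Reasoning
      leaves : List (Fin n)
      leaves = select (isLeaf T) (allFin n)
      leaf : ∀ {x} → x ∈ leaves → isLeaf T x ≡ true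
      leaf x∈ = proj₂ (∈-filter⁻ (λ x → isLeaf T x Bool.≟ true) {xs = allFin n} x∈)
      φ-leaves-unique : Unique (map φ leaves)
      φ-leaves-unique = unique-map⁺ φ (λ x∈ y∈ → φ-injective (leaf x∈) (leaf y∈))
        (UniqueP.filter⁺ _ (UniqueP.allFin⁺ n))
      window : ∀ {a b} → a ∈ map φ leaves → b ∈ map φ leaves → b ℤ.≤ a ℤ.+ + (suc m + d)
      window a∈ b∈ with _ , y∈ , refl ← ∈-map⁻ φ a∈ | _ , z∈ , refl ← ∈-map⁻ φ b∈ =
        leaves-window (leaf y∈) (leaf z∈)

theorem10 : ∀ (n : ℕ) (T : Graph n) → 2 ≤ n → IsTree T → ∀ (m : ℕ) → IsM T m →
    DefcAtLeast (tilde T) (numLeaves T ∸ m ∸ 2)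
theorem10 zero    _ () _
theorem10 (suc n) T _ tree m (_ , LP≤m) d att (t , c , colouring) = begin
  numLeaves T ∸ m ∸ 2
    ≤⟨ ℕP.∸-monoˡ-≤ 2 (ℕP.∸-monoˡ-≤ m (Lifting.numLeaves≤ T tree zero att colouring LP≤m)) ⟩
  suc (suc m + d) ∸ m ∸ 2
    ≡⟨ cong (λ k → k ∸ m ∸ 2) (sym (trans (ℕP.+-suc m (suc d)) (cong suc (ℕP.+-suc m d)))) ⟩
  m + (2 + d) ∸ m ∸ 2
    ≡⟨ cong (_∸ 2) (ℕP.m+n∸m≡n m (2 + d)) ⟩
  d ∎
  where open ℕP.≤-Reasoning
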